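{- Let $s\ge 7$ and $d>1$ be integers, and let $C_s^c$ denote the complement of the cycle $C_s$ of length $s$. Then $C_s^c$ is not the intersection graph of any family of $1$-boxes in $\mathbb{R}^d$.
   Context: A $1$-box in $\mathbb{R}^d$ is a nondegenerate compact segment parallel to one of the coordinate axes (a product of $d$ compact intervals exactly one of which is nondegenerate). The intersection graph of a finite family $\{X_1,\dots,X_k\}$ of sets has vertices $x_1,\dots,x_k$, with $x_ix_j$ an edge ($i\neq j$) iff $X_i\cap X_j\ne\emptyset$. -}

module Defs where

open import Level using (Level; _⊔_)
open import Data.Nat using (ℕ; zero; suc)
open import Data.Fin using (Fin; toℕ)
open import Data.Product using (Σ; _×_; ∃; proj₁)
open import Data.Sum using (_⊎_)
open import Relation.Nullary using (¬_)
open import Relation.Binary.PropositionalEquality using (_≡_; _≢_)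
open import Relation.Binary.Bundles using (TotalOrder)

-- Coordinates range over the carrier of an arbitrary total order T
-- (ℝ with its usual order being the case of the paper).
module _ {c ℓ₁ ℓ₂ : Level} (T : TotalOrder c ℓ₁ ℓ₂) where
  open TotalOrder T renaming (Carrier to A)

  _<ᵀ_ : A → A → Set (ℓ₁ ⊔ ℓ₂)
  x <ᵀ y = (x ≤ y) × ¬ (x ≈ y)

  record Box (d : ℕ) : Set c where
    constructor box
    field
      lo : Fin d → A
      hi : Fin d → A

  Is1Box : {d : ℕ} → Box d → Set (ℓ₁ ⊔ ℓ₂)
  Is1Box {d} B = Σ (Fin d) λ i →
      (Box.lo B i <ᵀ Box.hi B i)
    × (∀ j → j ≢ i → Box.lo B j ≈ Box.hi B j)

  OneBox : ℕ → Set (c ⊔ ℓ₁ ⊔ ℓ₂)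
  OneBox d = Σ (Box d) Is1Box

  _∈B_ : {d : ℕ} → (Fin d → A) → Box d → Set ℓ₂
  p ∈B B = ∀ j → (Box.lo B j ≤ p j) × (p j ≤ Box.hi B j)

  Meets : {d : ℕ} → OneBox d → OneBox d → Set (c ⊔ ℓ₂)
  Meets {d} X Y = Σ (Fin d → A) λ p → (p ∈B proj₁ X) × (p ∈B proj₁ Y)

CycleAdj : (s : ℕ) → Fin s → Fin s → Set
CycleAdj s i j =
    (suc (toℕ i) ≡ toℕ j) ⊎ (suc (toℕ j) ≡ toℕ i)
  ⊎ ((suc (toℕ i) ≡ s) × (toℕ j ≡ 0)) ⊎ ((suc (toℕ j) ≡ s) × (toℕ i ≡ 0))

CoCycleAdj : (s : ℕ) → Fin s → Fin s → Set
CoCycleAdj s i j = (i ≢ j) × ¬ CycleAdj s i j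

module _ {c ℓ₁ ℓ₂ : Level} (T : TotalOrder c ℓ₁ ℓ₂) where
  IsIntersectionGraphOf : {s d : ℕ} → (Fin s → Fin s → Set) → (Fin s → OneBox T d) → Set (c ⊔ ℓ₂)
  IsIntersectionGraphOf {s} G X =
    ∀ (i j : Fin s) → i ≢ j → (G i j → Meets T (X i) (X j)) × (Meets T (X i) (X j) → G i j)

-- Two facts about 1-boxes drive the argument.
--   (1) If W meets U and V, and the intervals of U and V overlap along the
--       axis of W, then U meets V: off that axis W is a single point, which
--       lies in both U and V.
--   (2) Consequently, if W and W' both meet two disjoint boxes U and V, then
--       W and W' are parallel: otherwise the constant coordinate of W' along
--       the axis of W lies in the intervals of both U and V.
-- Together with the one-dimensional fact that four intervals cannot realise
-- an induced 4-cycle, (1) shows that an induced 4-cycle U W V W' of 1-boxes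
-- cannot have U parallel to W.  In C_s^c the vertices 0 3 1 4 form an induced
-- 4-cycle, and (2) applied to the non-edges {2,3} and {0,1} makes the boxes
-- of 0 and 3 both parallel to the box of 5 — a contradiction.
module Submission where

open import Defs
open import Level using (Level; _⊔_)
open import Data.Nat using (ℕ; suc; _+_; _≤_; _<_; _≤?_)
open import Data.Nat.Properties
  using (≤-trans; ≤-reflexive; n≤1+n; <-irrefl; <-asym; n≮0; 1+n≢n; +-monoʳ-≤; m≤m+n; m≤n⇒∃[o]m+o≡n)
open import Data.Fin using (Fin; toℕ; #_; _≟_)
open import Data.Product using (Σ; _×_; _,_; proj₁; proj₂)
open import Data.Empty using (⊥-elim)
open import Data.Sum using (_⊎_; inj₁; inj₂; [_,_])
open import Relation.Nullary using (¬_; yes; no)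
open import Relation.Nullary.Decidable using (True; toWitness)
open import Relation.Binary.Bundles using (TotalOrder)
open import Relation.Binary.PropositionalEquality using (_≡_; _≢_; refl; sym; trans)

module OneBoxGeometry {c ℓ₁ ℓ₂ : Level} (T : TotalOrder c ℓ₁ ℓ₂) where
  open TotalOrder T renaming (Carrier to A; _≤_ to _⊑_; refl to ⊑-refl; trans to ⊑-trans)

  record Overlap (a b a' b' : A) : Set (c ⊔ ℓ₂) where
    constructor common
    field
      point : A
      a≤point : a ⊑ point
      point≤b : point ⊑ b
      a'≤point : a' ⊑ point
      point≤b' : point ⊑ b'

  -- Interval graphs contain no induced 4-cycle: if each of I, J meets each
  -- of K, L, then I meets J or K meets L.  If I lies weakly left of J, the
  -- right end of I lies in K and in L (and symmetrically); otherwise I and J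
  -- overlap at the larger of their left ends.
  intervals-no-C4 : ∀ {a b a' b' e f e' f'} →
    Overlap a b e f → Overlap a b e' f' → Overlap a' b' e f → Overlap a' b' e' f' →
    Overlap a b a' b' ⊎ Overlap e f e' f'
  intervals-no-C4 {a} {b} {a'} {b'}
    (common x a≤x x≤b e≤x x≤f) (common y a≤y y≤b e'≤y y≤f')
    (common z a'≤z z≤b' e≤z z≤f) (common t a'≤t t≤b' e'≤t t≤f')
    with total a' b | total a b'
  ... | inj₂ b≤a' | _ =
    inj₂ (common b (⊑-trans e≤x x≤b) (⊑-trans b≤a' (⊑-trans a'≤z z≤f))
                   (⊑-trans e'≤y y≤b) (⊑-trans b≤a' (⊑-trans a'≤t t≤f')))
  ... | inj₁ _ | inj₂ b'≤a =
    inj₂ (common b' (⊑-trans e≤z z≤b') (⊑-trans b'≤a (⊑-trans a≤x x≤f))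
                    (⊑-trans e'≤t t≤b') (⊑-trans b'≤a (⊑-trans a≤y y≤f')))
  ... | inj₁ a'≤b | inj₁ a≤b' with total a a'
  ...   | inj₁ a≤a' = inj₁ (common a' a≤a' a'≤b ⊑-refl (⊑-trans a'≤z z≤b'))
  ...   | inj₂ a'≤a = inj₁ (common a ⊑-refl (⊑-trans a≤x x≤b) a'≤a a≤b')

  module _ {d : ℕ} where
    lo hi : OneBox T d → Fin d → A
    lo X = Box.lo (proj₁ X)
    hi X = Box.hi (proj₁ X)

    axis : OneBox T d → Fin d
    axis X = proj₁ (proj₂ X)

    constant-off-axis : (X : OneBox T d) → ∀ j → j ≢ axis X → lo X j ≈ hi X j
    constant-off-axis X = proj₂ (proj₂ (proj₂ X))

    meets-sym : (X Y : OneBox T d) → Meets T X Y → Meets T Y X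
    meets-sym _ _ (p , p∈X , p∈Y) = p , p∈Y , p∈X

    meets-overlap : (X Y : OneBox T d) → Meets T X Y →
      ∀ k → Overlap (lo X k) (hi X k) (lo Y k) (hi Y k)
    meets-overlap _ _ (p , p∈X , p∈Y) k =
      common (p k) (proj₁ (p∈X k)) (proj₂ (p∈X k)) (proj₁ (p∈Y k)) (proj₂ (p∈Y k))

    off-axis-inside : (W U : OneBox T d) → Meets T W U → ∀ j → j ≢ axis W →
      (lo U j ⊑ lo W j) × (lo W j ⊑ hi U j)
    off-axis-inside W U (p , p∈W , p∈U) j j≢axis =
        ≤-respʳ-≈ (Eq.sym (constant-off-axis W j j≢axis)) (⊑-trans (proj₁ (p∈U j)) (proj₂ (p∈W j)))
      , ⊑-trans (proj₁ (p∈W j)) (proj₂ (p∈U j))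

    -- Fact (1): if W with axis k meets U and V, and U, V overlap along k,
    -- then U meets V at the point that agrees with W off the axis.
    meets-through : (U V W : OneBox T d) → Meets T W U → Meets T W V →
      ∀ k → axis W ≡ k → Overlap (lo U k) (hi U k) (lo V k) (hi V k) → Meets T U V
    meets-through U V W W∩U W∩V k axis≡k (common x lo-U≤x x≤hi-U lo-V≤x x≤hi-V) =
      p , p∈U , p∈V
      where
      p : Fin d → A
      p j with j ≟ k
      ... | yes _ = x
      ... | no _  = lo W j

      off-axis : ∀ {j} → j ≢ k → j ≢ axis W
      off-axis j≢k j≡axis = j≢k (trans j≡axis axis≡k)

      p∈U : ∀ j → (lo U j ⊑ p j) × (p j ⊑ hi U j)
      p∈U j with j ≟ k
      ... | yes refl = lo-U≤x , x≤hi-U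
      ... | no j≢k   = off-axis-inside W U W∩U j (off-axis j≢k)

      p∈V : ∀ j → (lo V j ⊑ p j) × (p j ⊑ hi V j)
      p∈V j with j ≟ k
      ... | yes refl = lo-V≤x , x≤hi-V
      ... | no j≢k   = off-axis-inside W V W∩V j (off-axis j≢k)

    common-neighbours-parallel : (U V W W' : OneBox T d) →
      Meets T W U → Meets T W V → Meets T W' U → Meets T W' V → ¬ Meets T U V →
      axis W ≡ axis W'
    common-neighbours-parallel U V W W' W∩U W∩V W'∩U W'∩V U∩V-empty
      with axis W ≟ axis W'
    ... | yes parallel = parallel
    ... | no crossing  = ⊥-elim (U∩V-empty (meets-through U V W W∩U W∩V (axis W) refl
            (common (lo W' (axis W)) (proj₁ in-U) (proj₂ in-U) (proj₁ in-V) (proj₂ in-V))))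
      where
      in-U : (lo U (axis W) ⊑ lo W' (axis W)) × (lo W' (axis W) ⊑ hi U (axis W))
      in-U = off-axis-inside W' U W'∩U (axis W) crossing
      in-V : (lo V (axis W) ⊑ lo W' (axis W)) × (lo W' (axis W) ⊑ hi V (axis W))
      in-V = off-axis-inside W' V W'∩V (axis W) crossing

    -- An induced 4-cycle U W V W' of 1-boxes with U parallel to W collapses:
    -- along the common axis the four intervals give an extra intersection.
    parallel-C4 : (U V W W' : OneBox T d) →
      Meets T U W → Meets T U W' → Meets T V W → Meets T V W' → axis U ≡ axis W →
      Meets T U V ⊎ Meets T W W'
    parallel-C4 U V W W' U∩W U∩W' V∩W V∩W' axisU≡axisW
      with intervals-no-C4 (meets-overlap U W U∩W (axis U)) (meets-overlap U W' U∩W' (axis U))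
                            (meets-overlap V W V∩W (axis U)) (meets-overlap V W' V∩W' (axis U))
    ... | inj₁ UV-overlap = inj₁ (meets-through U V W (meets-sym U W U∩W) (meets-sym V W V∩W)
                                    (axis U) (sym axisU≡axisW) UV-overlap)
    ... | inj₂ WW'-overlap = inj₂ (meets-through W W' U U∩W U∩W' (axis U) refl WW'-overlap)

far-apart-adjacent : ∀ {s} (i j : Fin s) → 2 + toℕ i ≤ toℕ j → 2 + toℕ j ≤ s → CoCycleAdj s i j
far-apart-adjacent {s} i j i+2≤j j+2≤s = i≢j , not-cycle-edge
  where
  i<j : toℕ i < toℕ j
  i<j = ≤-trans (n≤1+n _) i+2≤j

  i≢j : i ≢ j
  i≢j refl = <-irrefl refl i<j

  not-cycle-edge : ¬ CycleAdj s i j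
  not-cycle-edge (inj₁ i+1≡j)                    = <-irrefl i+1≡j i+2≤j
  not-cycle-edge (inj₂ (inj₁ j+1≡i))             = <-asym i<j (≤-reflexive j+1≡i)
  not-cycle-edge (inj₂ (inj₂ (inj₁ (_ , j≡0))))  = n≮0 (≤-trans i+2≤j (≤-reflexive j≡0))
  not-cycle-edge (inj₂ (inj₂ (inj₂ (j+1≡s , _)))) = <-irrefl j+1≡s j+2≤s

module Realisation {c ℓ₁ ℓ₂ : Level} (T : TotalOrder c ℓ₁ ℓ₂) {s d : ℕ}
  (X : Fin s → OneBox T d) (realises : IsIntersectionGraphOf T (CoCycleAdj s) X) where

  adjacent-meet : (i j : Fin s) → CoCycleAdj s i j → Meets T (X i) (X j)
  adjacent-meet i j adj = proj₁ (realises i j (proj₁ adj)) adj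

  consecutive-disjoint : (i j : Fin s) → suc (toℕ i) ≡ toℕ j → ¬ Meets T (X i) (X j)
  consecutive-disjoint i j i+1≡j X-i∩X-j = proj₂ (proj₂ (realises i j i≢j) X-i∩X-j) (inj₁ i+1≡j)
    where
    i≢j : i ≢ j
    i≢j refl = 1+n≢n i+1≡j

no-realisation : ∀ {c ℓ₁ ℓ₂ : Level} (T : TotalOrder c ℓ₁ ℓ₂) (n d : ℕ) (X : Fin (7 + n) → OneBox T d) →
  ¬ IsIntersectionGraphOf T (CoCycleAdj (7 + n)) X
no-realisation T n d X realises =
  [ consecutive-disjoint (# 0) (# 1) refl , consecutive-disjoint (# 3) (# 4) refl ]
    (parallel-C4 (X (# 0)) (X (# 1)) (X (# 3)) (X (# 4))
      (meet (# 0) (# 3)) (meet (# 0) (# 4)) (meet (# 1) (# 3)) (meet (# 1) (# 4))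
      (trans axis0≡axis5 (sym axis3≡axis5)))
  where
  open OneBoxGeometry T
  open Realisation T X realises

  meet : (i j : Fin (7 + n)) → {True (2 + toℕ i ≤? toℕ j)} → {True (toℕ j ≤? 5)} → Meets T (X i) (X j)
  meet i j {i+2≤j} {j≤5} = adjacent-meet i j (far-apart-adjacent i j (toWitness i+2≤j)
    (≤-trans (+-monoʳ-≤ 2 (toWitness j≤5)) (m≤m+n 7 n)))

  axis0≡axis5 : axis (X (# 0)) ≡ axis (X (# 5))
  axis0≡axis5 = common-neighbours-parallel (X (# 2)) (X (# 3)) (X (# 0)) (X (# 5))
    (meet (# 0) (# 2)) (meet (# 0) (# 3))
    (meets-sym (X (# 2)) (X (# 5)) (meet (# 2) (# 5))) (meets-sym (X (# 3)) (X (# 5)) (meet (# 3) (# 5)))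
    (consecutive-disjoint (# 2) (# 3) refl)

  axis3≡axis5 : axis (X (# 3)) ≡ axis (X (# 5))
  axis3≡axis5 = common-neighbours-parallel (X (# 0)) (X (# 1)) (X (# 3)) (X (# 5))
    (meets-sym (X (# 0)) (X (# 3)) (meet (# 0) (# 3))) (meets-sym (X (# 1)) (X (# 3)) (meet (# 1) (# 3)))
    (meets-sym (X (# 0)) (X (# 5)) (meet (# 0) (# 5))) (meets-sym (X (# 1)) (X (# 5)) (meet (# 1) (# 5)))
    (consecutive-disjoint (# 0) (# 1) refl)

lemma2 : ∀ {c ℓ₁ ℓ₂ : Level} (T : TotalOrder c ℓ₁ ℓ₂) (s d : ℕ) → 7 ≤ s → 1 < d →
    ¬ (Σ (Fin s → OneBox T d) λ X → IsIntersectionGraphOf T (CoCycleAdj s) X)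
lemma2 T s d 7≤s _ (X , realises) with m≤n⇒∃[o]m+o≡n 7≤s
... | n , refl = no-realisation T n d X realises
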